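{- Let $n,k,t$ be integers with $0\le k\le n-1$, and let $R=\lfloor\frac{n-k-1}{2}\rfloor$. Suppose there exists an $(n,2^t,R)$ covering code. Then $\mathrm{D_{cc}^{\rightarrow}}(F_k)\le t$, where $F_k(x,y)=f_k(x\oplus y)$ and $f_k\colon\{0,1\}^n\to\{0,1,\perp\}$ is given by $f_k(x)=0$ if $|x|\le k$, $f_k(x)=\perp$ if $k+1\le|x|\le n-1$, $f_k(x)=1$ if $|x|=n$.
   Context: $|x|$ is Hamming weight and $\operatorname{dist}$ Hamming distance. A set $\mathcal C\subseteq\{0,1\}^n$ is an $(n,K,R)$ covering code if $|\mathcal C|\le K$ and every $x\in\{0,1\}^n$ has some $c\in\mathcal C$ with $\operatorname{dist}(x,c)\le R$. For a partial $f$, $\operatorname{Dom}(f)=f^{ -1}(\{0,1\})$, $\oplus$ is bitwise XOR, and $F(x,y)=f(x\oplus y)$ with $\operatorname{Dom}(F)=\{(x,y):x\oplus y\in\operatorname{Dom}(f)\}$. A one-way protocol of cost $t$ for $F$ consists of total functions $h\colon\{0,1\}^n\to\{0,1\}^t$ and $\varphi\colon\{0,1\}^t\times\{0,1\}^n\to\{0,1\}$ with $\varphi(h(x),y)=F(x,y)$ for all $(x,y)\in\operatorname{Dom}(F)$; $\mathrm{D_{cc}^{\rightarrow}}(F)$ is the minimum such $t$. -}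

module Defs where

open import Data.Nat using (ℕ; zero; suc; _+_; _∸_; _^_; _≤_; _<_; _≤ᵇ_; _≡ᵇ_)
open import Data.Nat.DivMod using (_/_)
open import Data.Bool using (Bool; true; false; if_then_else_; _xor_)
open import Data.Maybe using (Maybe; just; nothing)
open import Data.Vec using (Vec; []; _∷_; zipWith)
open import Data.List using (List; length)
open import Data.List.Membership.Propositional using (_∈_)
open import Data.Product using (Σ; ∃; ∃-syntax; _×_; _,_)
open import Relation.Binary.PropositionalEquality using (_≡_)

BitStr : ℕ → Set
BitStr n = Vec Bool n

weight : ∀ {n} → BitStr n → ℕ
weight [] = 0
weight (true ∷ x) = suc (weight x)
weight (false ∷ x) = weight x

_⊕_ : ∀ {n} → BitStr n → BitStr n → BitStr n
x ⊕ y = zipWith _xor_ x y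

dist : ∀ {n} → BitStr n → BitStr n → ℕ
dist x y = weight (x ⊕ y)

-- (n, K, R) covering code: a list of codewords (|C| ≤ length ≤ K)
-- covering every word within radius R
IsCoveringCode : (n K R : ℕ) → List (BitStr n) → Set
IsCoveringCode n K R C =
  length C ≤ K × ((x : BitStr n) → ∃[ c ] (c ∈ C × dist x c ≤ R))

CoveringCodeExists : (n K R : ℕ) → Set
CoveringCodeExists n K R = ∃[ C ] IsCoveringCode n K R C

-- partial Boolean function: nothing = ⊥ (undefined)
Partial : ℕ → Set
Partial n = BitStr n → Maybe Bool

xorLift : ∀ {n} → Partial n → BitStr n → BitStr n → Maybe Bool
xorLift f x y = f (x ⊕ y)

OneWayProtocol : ∀ {n} → (BitStr n → BitStr n → Maybe Bool) → ℕ → Set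
OneWayProtocol {n} F t =
  Σ (BitStr n → BitStr t) λ h →
  Σ (BitStr t → BitStr n → Bool) λ φ →
  (x y : BitStr n) (b : Bool) → F x y ≡ just b → φ (h x) y ≡ b

Dcc≤ : ∀ {n} → (BitStr n → BitStr n → Maybe Bool) → ℕ → Set
Dcc≤ F t = ∃[ s ] (s ≤ t × OneWayProtocol F s)

f : (n k : ℕ) → Partial n
f n k x = if weight x ≤ᵇ k then just false
          else (if weight x ≡ᵇ n then just true else nothing)

-- Alice sends the t-bit address of a codeword c with dist(x, c) ≤ R; Bob answers 1 iff
-- dist(c, y) > k + R.  By the triangle inequality dist(c, y) ≤ k + R when |x ⊕ y| ≤ k,
-- while dist(c, y) ≥ n − R > k + R when |x ⊕ y| = n, because k + 2R ≤ n − 1.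
module Submission where

open import Defs

open import Data.Bool using (Bool; true; false; _xor_)
open import Data.Bool.Properties using (xor-assoc; xor-same; xor-comm)
open import Data.List using (List; []; _∷_; length; take; drop)
open import Data.List.Properties using (length-take; length-drop; take++drop≡id)
open import Data.List.Membership.Propositional using (_∈_)
open import Data.List.Membership.Propositional.Properties using (∈-++⁻)
open import Data.List.Relation.Unary.Any using (here)
open import Data.Maybe using (Maybe; just; nothing; maybe)
open import Data.Nat using (ℕ; suc; _+_; _*_; _∸_; _^_; _≤_; _<_; _≤ᵇ_; _≡ᵇ_; z≤n; s≤s; _<?_)
open import Data.Nat.DivMod using (_/_; m/n*n≤m)
open import Data.Nat.Properties
open import Data.Product using (Σ; ∃-syntax; _,_; proj₁; proj₂; map)
open import Data.Sum using (inj₁; inj₂)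
open import Data.Vec using ([]; _∷_)
open import Data.Vec.Properties using (zipWith-comm)
open import Function using (id)
open import Relation.Nullary.Decidable using (does; dec-true; dec-false)
open import Relation.Binary.PropositionalEquality

weight-⊕-≤ : ∀ {n} (u v : BitStr n) → weight (u ⊕ v) ≤ weight u + weight v
weight-⊕-≤ []          []          = z≤n
weight-⊕-≤ (true ∷ u)  (true ∷ v)  =
  ≤-trans (weight-⊕-≤ u v) (≤-trans (+-monoʳ-≤ (weight u) (n≤1+n _)) (n≤1+n _))
weight-⊕-≤ (true ∷ u)  (false ∷ v) = s≤s (weight-⊕-≤ u v)
weight-⊕-≤ (false ∷ u) (true ∷ v)  =
  ≤-trans (s≤s (weight-⊕-≤ u v)) (≤-reflexive (sym (+-suc (weight u) (weight v))))
weight-⊕-≤ (false ∷ u) (false ∷ v) = weight-⊕-≤ u v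

xor-cancel-middle : ∀ a b c → (a xor b) xor (b xor c) ≡ a xor c
xor-cancel-middle a b c = begin
  (a xor b) xor (b xor c) ≡⟨ xor-assoc a b (b xor c) ⟩
  a xor (b xor (b xor c)) ≡⟨ cong (a xor_) (sym (xor-assoc b b c)) ⟩
  a xor ((b xor b) xor c) ≡⟨ cong (λ d → a xor (d xor c)) (xor-same b) ⟩
  a xor c                 ∎
  where open ≡-Reasoning

⊕-cancel-middle : ∀ {n} (x y z : BitStr n) → (x ⊕ y) ⊕ (y ⊕ z) ≡ x ⊕ z
⊕-cancel-middle []      []      []      = refl
⊕-cancel-middle (a ∷ x) (b ∷ y) (c ∷ z) =
  cong₂ _∷_ (xor-cancel-middle a b c) (⊕-cancel-middle x y z)

dist-sym : ∀ {n} (x y : BitStr n) → dist x y ≡ dist y x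
dist-sym x y = cong weight (zipWith-comm xor-comm x y)

dist-triangle : ∀ {n} (x y z : BitStr n) → dist x z ≤ dist x y + dist y z
dist-triangle x y z =
  subst (_≤ dist x y + dist y z) (cong weight (⊕-cancel-middle x y z))
        (weight-⊕-≤ (x ⊕ y) (y ⊕ z))

Addressing : {A : Set} → ℕ → List A → Set
Addressing {A} t C = Σ (BitStr t → Maybe A) λ resolve → ∀ {c} → c ∈ C → ∃[ m ] resolve m ≡ just c

-- The first address bit selects one of the two halves of length at most 2 ^ t.
addressing : {A : Set} (t : ℕ) (C : List A) → length C ≤ 2 ^ t → Addressing t C
addressing     0       []          _           = (λ _ → nothing) , λ ()
addressing     0       (a ∷ [])    _           = (λ _ → just a) , λ { (here refl) → [] , refl }
addressing     0       (_ ∷ _ ∷ _) (s≤s ())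
addressing {A} (suc t) C           |C|≤2^[1+t] = resolve , address
  where
  half : ℕ
  half = 2 ^ t

  front : Addressing t (take half C)
  front = addressing t (take half C)
    (subst (_≤ half) (sym (length-take half C)) (m⊓n≤m half (length C)))

  back : Addressing t (drop half C)
  back = addressing t (drop half C)
    (subst (_≤ half) (sym (length-drop half C))
      (m≤n+o⇒m∸n≤o (length C) half
        (subst (length C ≤_) (cong (half +_) (+-identityʳ half)) |C|≤2^[1+t])))

  resolve : BitStr (suc t) → Maybe A
  resolve (false ∷ m) = proj₁ front m
  resolve (true ∷ m)  = proj₁ back m

  address : ∀ {c} → c ∈ C → ∃[ m ] resolve m ≡ just c
  address {c} c∈C with ∈-++⁻ (take half C) (subst (c ∈_) (sym (take++drop≡id half C)) c∈C)
  ... | inj₁ c∈front = map (false ∷_) id (proj₂ front c∈front)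
  ... | inj₂ c∈back  = map (true ∷_) id (proj₂ back c∈back)

module GapProtocol {n} (g : Partial n) (a b R : ℕ)
  (false⇒≤a : ∀ z → g z ≡ just false → weight z ≤ a)
  (true⇒≥b  : ∀ z → g z ≡ just true → b ≤ weight z)
  (gap      : a + R + R < b)
  where

  decide : BitStr n → BitStr n → Bool
  decide c y = does (a + R <? dist c y)

  decide-correct : ∀ x y c → dist x c ≤ R → ∀ v → xorLift g x y ≡ just v → decide c y ≡ v
  decide-correct x y c x≈c false gxy≡0 = dec-false (a + R <? dist c y) (≤⇒≯ close)
    where
    open ≤-Reasoning
    close : dist c y ≤ a + R
    close = begin
      dist c y            ≤⟨ dist-triangle c x y ⟩
      dist c x + dist x y ≡⟨ +-comm (dist c x) (dist x y) ⟩
      dist x y + dist c x ≡⟨ cong (dist x y +_) (dist-sym c x) ⟩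
      dist x y + dist x c ≤⟨ +-mono-≤ (false⇒≤a (x ⊕ y) gxy≡0) x≈c ⟩
      a + R               ∎
  decide-correct x y c x≈c true gxy≡1 = dec-true (a + R <? dist c y) (+-cancelʳ-< R (a + R) (dist c y) far)
    where
    open ≤-Reasoning
    far : a + R + R < dist c y + R
    far = begin-strict
      a + R + R           <⟨ gap ⟩
      b                   ≤⟨ true⇒≥b (x ⊕ y) gxy≡1 ⟩
      dist x y            ≤⟨ dist-triangle x c y ⟩
      dist x c + dist c y ≤⟨ +-monoˡ-≤ (dist c y) x≈c ⟩
      R + dist c y        ≡⟨ +-comm R (dist c y) ⟩
      dist c y + R        ∎

  protocol : ∀ t → CoveringCodeExists n (2 ^ t) R → OneWayProtocol (xorLift g) t
  protocol t (C , |C|≤2^t , cover) = h , φ , correct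
    where
    resolve : BitStr t → Maybe (BitStr n)
    resolve = proj₁ (addressing t C |C|≤2^t)

    address : ∀ {c} → c ∈ C → ∃[ m ] resolve m ≡ just c
    address = proj₂ (addressing t C |C|≤2^t)

    h : BitStr n → BitStr t
    h x = proj₁ (address (proj₁ (proj₂ (cover x))))

    φ : BitStr t → BitStr n → Bool
    φ m y = maybe (λ c → decide c y) false (resolve m)

    correct : ∀ x y v → xorLift g x y ≡ just v → φ (h x) y ≡ v
    correct x y v gxy≡v with cover x
    ... | c , c∈C , x≈c rewrite proj₂ (address c∈C) = decide-correct x y c x≈c v gxy≡v

f≡false⇒weight≤ : ∀ n k z → f n k z ≡ just false → weight z ≤ k
f≡false⇒weight≤ n k z fz≡0 with weight z ≤ᵇ k | ≤ᵇ⇒≤ (weight z) k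
... | true  | weight≤k = weight≤k _
... | false | _ with weight z ≡ᵇ n
f≡false⇒weight≤ n k z () | false | _ | true
f≡false⇒weight≤ n k z () | false | _ | false

f≡true⇒weight≥ : ∀ n k z → f n k z ≡ just true → n ≤ weight z
f≡true⇒weight≥ n k z fz≡1 with weight z ≤ᵇ k
f≡true⇒weight≥ n k z () | true
... | false with weight z ≡ᵇ n | ≡ᵇ⇒≡ (weight z) n
... | true  | weight≡n = ≤-reflexive (sym (weight≡n _))
f≡true⇒weight≥ n k z () | false | false | _

half+half≤ : ∀ m → m / 2 + m / 2 ≤ m
half+half≤ m = begin
  m / 2 + m / 2       ≡⟨ cong (m / 2 +_) (sym (+-identityʳ (m / 2))) ⟩
  2 * (m / 2)         ≡⟨ *-comm 2 (m / 2) ⟩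
  m / 2 * 2           ≤⟨ m/n*n≤m m 2 ⟩
  m                   ∎
  where open ≤-Reasoning

radius-gap : ∀ {n k} → k < n → k + (n ∸ k ∸ 1) / 2 + (n ∸ k ∸ 1) / 2 < n
radius-gap {n} {k} k<n = begin-strict
  k + R + R           ≡⟨ +-assoc k R R ⟩
  k + (R + R)         ≤⟨ +-monoʳ-≤ k (half+half≤ (n ∸ k ∸ 1)) ⟩
  k + (n ∸ k ∸ 1)     ≡⟨ cong (k +_) (∸-+-assoc n k 1) ⟩
  k + (n ∸ (k + 1))   ≡⟨ cong (λ j → k + (n ∸ j)) (+-comm k 1) ⟩
  k + (n ∸ suc k)     <⟨ n<1+n _ ⟩
  suc k + (n ∸ suc k) ≡⟨ m+[n∸m]≡n k<n ⟩
  n                   ∎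
  where
  open ≤-Reasoning
  R : ℕ
  R = (n ∸ k ∸ 1) / 2

theorem28 : (n k t : ℕ) → k < n →
    CoveringCodeExists n (2 ^ t) ((n ∸ k ∸ 1) / 2) →
    Dcc≤ (xorLift (f n k)) t
theorem28 n k t k<n code = t , ≤-refl , GapProtocol.protocol (f n k) k n ((n ∸ k ∸ 1) / 2)
  (f≡false⇒weight≤ n k) (f≡true⇒weight≥ n k) (radius-gap k<n) t code
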